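{- Let $1\le m<n$, let $P$ be an $(m-1)$-subspace and $Q$ an $(m+1)$-subspace of $\mathbb{Z}_{p^s}^n$. In $G_{p^s}(n,m)$, if $[P\rangle_m\cap\langle Q]_m\neq \emptyset$, then $\left| [P\rangle_m\cap\langle Q]_m \right|=p^{s-1}(p+1)$.
   Context: $p$ is a prime, $s\ge1$, $R=\mathbb{Z}_{p^s}$; vectors are row vectors. A set of $k$ vectors is unimodular if the matrix with those rows has a right inverse over $R$. A $k$-subspace ($k\ge1$) is a submodule of $R^n$ with a unimodular basis of $k$ vectors; the $0$-subspace is $\{0\}$. $G_{p^s}(n,m)$ has vertex set the $m$-subspaces of $R^n$. The star $[P\rangle_m$ is the set of all $m$-subspaces containing $P$; the top $\langle Q]_m$ is the set of all $m$-subspaces contained in $Q$. -}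

module Defs where

open import Data.Nat using (ℕ; zero; suc; _+_; _*_; _^_)
open import Data.Fin using (Fin; zero; suc)
open import Data.Product using (Σ; ∃; ∃₂; _×_; _,_)
open import Relation.Binary.PropositionalEquality using (_≡_; _≢_)
open import Relation.Nullary using (¬_; yes; no)
open import Data.Fin using (_≟_)

-- Elements of R = ℤ_q (q = p^s) are represented by natural numbers,
-- with equality being congruence modulo q.
_≈[_]_ : ℕ → ℕ → ℕ → Set
x ≈[ q ] y = ∃₂ λ a b → x + a * q ≡ y + b * q

∑ : ∀ {k} → (Fin k → ℕ) → ℕ
∑ {zero}  f = 0
∑ {suc k} f = f zero + ∑ (λ i → f (suc i))

Vect : ℕ → Set
Vect n = Fin n → ℕ

Mat : ℕ → ℕ → Set
Mat k n = Fin k → Fin n → ℕ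

_·_ : ∀ {k l n} → Mat k l → Mat l n → Mat k n
(A · B) i j = ∑ (λ t → A i t * B t j)

MatEq : ℕ → ∀ {k n} → Mat k n → Mat k n → Set
MatEq q A B = ∀ i j → A i j ≈[ q ] B i j

identity : ∀ k → Mat k k
identity k i j with i ≟ j
... | yes _ = 1
... | no _ = 0

Unimodular : ℕ → ∀ {k n} → Mat k n → Set
Unimodular q {k} {n} B = Σ (Mat n k) λ C → MatEq q (B · C) (identity k)

InSpan : ℕ → ∀ {k n} → Mat k n → Vect n → Set
InSpan q {k} {n} B v = Σ (Fin k → ℕ) λ c → ∀ j → ∑ (λ i → c i * B i j) ≈[ q ] v j

_⊆[_]_ : ∀ {k l n} → Mat k n → ℕ → Mat l n → Set
A ⊆[ q ] B = ∀ v → InSpan q A v → InSpan q B v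

SameSpan : ℕ → ∀ {k l n} → Mat k n → Mat l n → Set
SameSpan q A B = (A ⊆[ q ] B) × (B ⊆[ q ] A)

-- An m-subspace is the span of a unimodular m×n matrix (for m = 0 this is {0}).
-- The star-top intersection [P⟩_m ∩ ⟨Q]_m, as a predicate on bases X:
InStarTop : ℕ → ∀ {a b m n} → Mat a n → Mat b n → Mat m n → Set
InStarTop q P Q X = Unimodular q X × (P ⊆[ q ] X) × (X ⊆[ q ] Q)

HasCard : ℕ → ∀ {m n} → (Mat m n → Set) → ℕ → Set
HasCard q {m} {n} S N =
  Σ (Fin N → Mat m n) λ L →
    (∀ i → S (L i)) ×
    (∀ i j → i ≢ j → ¬ SameSpan q (L i) (L j)) ×
    (∀ X → S X → ∃ λ i → SameSpan q X (L i))

-- Let D be a right inverse of P. Inside Q there are u, w with u D = w D = 0 and, at two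
-- coordinates j, j′, (u_j, u_j′) = (1, 0) and (w_j, w_j′) = (0, 1); then Q = P ⊕ R u ⊕ R w.
-- An m-space X between P and Q is P + R (β u + γ w) with β or γ a unit. If β is a unit then
-- X = ⟨P, u + a w⟩ for a unique a ∈ ℤ/p^s; otherwise p ∣ β and X = ⟨P, w + p b u⟩ for a unique
-- b ∈ ℤ/p^(s-1). So there are p^s + p^(s-1) of them. Independence is always settled by counting
-- (a unimodular k-row matrix spans only (p^s)^k residue vectors), and the unit entries needed
-- for u and w exist because reduction modulo p cannot lower the rank of a unimodular matrix.

module Submission where

open import Defs
open import Data.Empty using (⊥-elim)
open import Data.Fin using (Fin; zero; suc; toℕ; fromℕ<; funToFin; finToFun; combine; splitAt; join; _↑ˡ_; _↑ʳ_)
open import Data.Fin.Properties using (toℕ-fromℕ<; toℕ-injective; toℕ<n; injective⇒≤; finToFun-funToFin; funToFin-finToFin; join-splitAt; splitAt-↑ˡ; splitAt-↑ʳ; ¬∀⟶∃¬; all?)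
open import Data.Nat using (ℕ; zero; suc; z<s; _+_; _*_; _^_; _∸_; _≤_; _<_; NonZero; _%_; _/_; nonTrivial⇒n>1)
open import Data.Nat.Coprimality using (Coprime; coprime-divisor; coprime-Bézout)
open import Data.Nat.DivMod using (m≡m%n+[m/n]*n; [m+kn]%n≡m%n; m%n<n; m%n%n≡m%n; m<n⇒m%n≡m)
open import Data.Nat.Divisibility using (_∣_; _∣?_; divides; ∣-trans; ∣1⇒≡1; ∣n⇒∣m*n; m∣m*n)
open import Data.Nat.GCD using (module Bézout)
open import Data.Nat.Primality using (Prime; prime⇒irreducible; prime⇒nonZero; prime⇒nonTrivial)
open import Data.Nat.Properties
open import Data.Nat.Tactic.RingSolver using (solve-∀)
open import Data.Product using (∃; ∃₂; _×_; _,_; proj₁; proj₂; swap)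
open import Data.Sum using (_⊎_; inj₁; inj₂; [_,_]′)
open import Data.Vec.Functional using (_∷_; tail)
open import Relation.Binary.Bundles using (Setoid)
open import Relation.Binary.PropositionalEquality
open import Relation.Nullary using (¬_; Dec; yes; no)
open import Relation.Nullary.Decidable using (_×-dec_; decidable-stable)
import Relation.Binary.Reasoning.Setoid as SetoidReasoning
open import Function using (_∘_)

≈-refl : ∀ {d x} → x ≈[ d ] x
≈-refl = 0 , 0 , refl

≈-sym : ∀ {d x y} → x ≈[ d ] y → y ≈[ d ] x
≈-sym (a , b , e) = b , a , sym e

≈-trans : ∀ {d x y z} → x ≈[ d ] y → y ≈[ d ] z → x ≈[ d ] z
≈-trans {d} {x} {y} {z} (a , b , x≡y) (c , e , y≡z) = a + c , b + e , (begin
  x + (a + c) * d      ≡⟨ regroup x a c d ⟩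
  (x + a * d) + c * d  ≡⟨ cong (_+ c * d) x≡y ⟩
  (y + b * d) + c * d  ≡⟨ exchange y b c d ⟩
  (y + c * d) + b * d  ≡⟨ cong (_+ b * d) y≡z ⟩
  (z + e * d) + b * d  ≡⟨ exchange z e b d ⟩
  (z + b * d) + e * d  ≡⟨ regroup z b e d ⟨
  z + (b + e) * d      ∎)
  where
  open ≡-Reasoning
  regroup : ∀ x a c d → x + (a + c) * d ≡ (x + a * d) + c * d
  regroup = solve-∀
  exchange : ∀ y b c d → (y + b * d) + c * d ≡ (y + c * d) + b * d
  exchange = solve-∀

≡⇒≈ : ∀ {d x y} → x ≡ y → x ≈[ d ] y
≡⇒≈ refl = ≈-refl

≈-setoid : ℕ → Setoid _ _
≈-setoid d = record
  { Carrier = ℕ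
  ; _≈_ = _≈[ d ]_
  ; isEquivalence = record { refl = ≈-refl ; sym = ≈-sym ; trans = ≈-trans }
  }

module ≈-Reasoning (d : ℕ) = SetoidReasoning (≈-setoid d)

+-cong : ∀ {d x y x′ y′} → x ≈[ d ] x′ → y ≈[ d ] y′ → (x + y) ≈[ d ] (x′ + y′)
+-cong {d} {x} {y} {x′} {y′} (a , b , e) (c , f , e′) = a + c , b + f , (begin
  (x + y) + (a + c) * d        ≡⟨ regroup x y a c d ⟩
  (x + a * d) + (y + c * d)    ≡⟨ cong₂ _+_ e e′ ⟩
  (x′ + b * d) + (y′ + f * d)  ≡⟨ regroup x′ y′ b f d ⟨
  (x′ + y′) + (b + f) * d      ∎)
  where
  open ≡-Reasoning
  regroup : ∀ x y a c d → (x + y) + (a + c) * d ≡ (x + a * d) + (y + c * d)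
  regroup = solve-∀

*-congˡ : ∀ {d x x′} c → x ≈[ d ] x′ → (c * x) ≈[ d ] (c * x′)
*-congˡ {d} {x} {x′} c (a , b , e) = c * a , c * b , (begin
  c * x + c * a * d   ≡⟨ factor c x a d ⟩
  c * (x + a * d)     ≡⟨ cong (c *_) e ⟩
  c * (x′ + b * d)    ≡⟨ factor c x′ b d ⟨
  c * x′ + c * b * d  ∎)
  where
  open ≡-Reasoning
  factor : ∀ c x a d → c * x + c * a * d ≡ c * (x + a * d)
  factor = solve-∀

*-congʳ : ∀ {d x x′} c → x ≈[ d ] x′ → (x * c) ≈[ d ] (x′ * c)
*-congʳ {x = x} {x′} c e = ≈-trans (≡⇒≈ (*-comm x c)) (≈-trans (*-congˡ c e) (≡⇒≈ (*-comm c x′)))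

+-cancelˡ-≈ : ∀ {d a a′ x x′} → a ≈[ d ] a′ → (a + x) ≈[ d ] (a′ + x′) → x ≈[ d ] x′
+-cancelˡ-≈ {d} {a} {a′} {x} {x′} a≈a′ h with ≈-trans h (+-cong (≈-sym a≈a′) (≈-refl {x = x′}))
... | k , l , e = k , l , +-cancelˡ-≡ a _ _ (trans (sym (+-assoc a x _)) (trans e (+-assoc a x′ _)))

≈-weaken : ∀ {d x y} e → x ≈[ d * e ] y → x ≈[ d ] y
≈-weaken {d} {x} {y} e (a , b , eq) = a * e , b * e , (begin
  x + a * e * d      ≡⟨ cong (x +_) (reassoc a e d) ⟩
  x + a * (d * e)    ≡⟨ eq ⟩
  y + b * (d * e)    ≡⟨ cong (y +_) (reassoc b e d) ⟨
  y + b * e * d      ∎)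
  where
  open ≡-Reasoning
  reassoc : ∀ a e d → a * e * d ≡ a * (d * e)
  reassoc = solve-∀

∣⇒≈0 : ∀ {d x} → d ∣ x → x ≈[ d ] 0
∣⇒≈0 {x = x} (divides c eq) = 0 , c , trans (+-identityʳ x) eq

-- ℕ has no negatives: modulo d, -x is represented by (d ∸ 1) * x.
+-inverse : ∀ d .{{_ : NonZero d}} x → (x + (d ∸ 1) * x) ≈[ d ] 0
+-inverse (suc d) x = 0 , x , trans (+-identityʳ _) (*-comm (suc d) x)

+-inverse-absorb : ∀ d .{{_ : NonZero d}} a b → (a + (d ∸ 1) * b + b) ≈[ d ] a
+-inverse-absorb (suc d) a b = 0 , b , absorb a b d
  where
  absorb : ∀ a b d → a + d * b + b + 0 ≡ a + b * suc d
  absorb = solve-∀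

≈-move : ∀ {d} .{{_ : NonZero d}} {a b c} → (a + (d ∸ 1) * b) ≈[ d ] c → a ≈[ d ] (c + b)
≈-move {d} {a} {b} h = ≈-trans (≈-sym (+-inverse-absorb d a b)) (+-cong h ≈-refl)

≈⇒%≡ : ∀ {d x y} .{{_ : NonZero d}} → x ≈[ d ] y → x % d ≡ y % d
≈⇒%≡ {d} {x} {y} (a , b , e) = trans (sym ([m+kn]%n≡m%n x a d)) (trans (cong (_% d) e) ([m+kn]%n≡m%n y b d))

%≡⇒≈ : ∀ {d x y} .{{_ : NonZero d}} → x % d ≡ y % d → x ≈[ d ] y
%≡⇒≈ {d} {x} {y} e = y / d , x / d , (begin
  x + y / d * d                  ≡⟨ cong (_+ y / d * d) (m≡m%n+[m/n]*n x d) ⟩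
  x % d + x / d * d + y / d * d  ≡⟨ cong (λ t → t + x / d * d + y / d * d) e ⟩
  y % d + x / d * d + y / d * d  ≡⟨ exchange (y % d) (x / d * d) (y / d * d) ⟩
  y % d + y / d * d + x / d * d  ≡⟨ cong (_+ x / d * d) (m≡m%n+[m/n]*n y d) ⟨
  y + x / d * d                  ∎)
  where
  open ≡-Reasoning
  exchange : ∀ a b c → a + b + c ≡ a + c + b
  exchange = solve-∀

≈? : ∀ d .{{_ : NonZero d}} x y → Dec (x ≈[ d ] y)
≈? d x y with x % d Data.Nat.≟ y % d
... | yes e = yes (%≡⇒≈ e)
... | no ne = no (λ e → ne (≈⇒%≡ e))

m%n≈m : ∀ {d} .{{_ : NonZero d}} x → (x % d) ≈[ d ] x
m%n≈m {d} x = %≡⇒≈ (m%n%n≡m%n x d)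

≈-reduced⇒≡ : ∀ {d x y} .{{_ : NonZero d}} → x ≈[ d ] y → x < d → y < d → x ≡ y
≈-reduced⇒≡ e x<d y<d = trans (sym (m<n⇒m%n≡m x<d)) (trans (≈⇒%≡ e) (m<n⇒m%n≡m y<d))

∑-cong : ∀ {k} {f g : Fin k → ℕ} → (∀ i → f i ≡ g i) → ∑ f ≡ ∑ g
∑-cong {zero} e = refl
∑-cong {suc k} e = cong₂ _+_ (e zero) (∑-cong (λ i → e (suc i)))

∑-cong≈ : ∀ {d k} {f g : Fin k → ℕ} → (∀ i → f i ≈[ d ] g i) → ∑ f ≈[ d ] ∑ g
∑-cong≈ {k = zero} e = ≈-refl
∑-cong≈ {k = suc k} e = +-cong (e zero) (∑-cong≈ (λ i → e (suc i)))

∑-distrib-+ : ∀ {k} (f g : Fin k → ℕ) → ∑ (λ i → f i + g i) ≡ ∑ f + ∑ g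
∑-distrib-+ {zero} f g = refl
∑-distrib-+ {suc k} f g =
  trans (cong (f zero + g zero +_) (∑-distrib-+ (λ i → f (suc i)) (λ i → g (suc i)))) (interchange (f zero) (g zero) _ _)
  where
  interchange : ∀ a b c d → a + b + (c + d) ≡ a + c + (b + d)
  interchange = solve-∀

∑-*ˡ : ∀ {k} c (f : Fin k → ℕ) → ∑ (λ i → c * f i) ≡ c * ∑ f
∑-*ˡ {zero} c f = sym (*-zeroʳ c)
∑-*ˡ {suc k} c f = trans (cong (c * f zero +_) (∑-*ˡ c (λ i → f (suc i)))) (sym (*-distribˡ-+ c _ _))

∑-*ʳ : ∀ {k} c (f : Fin k → ℕ) → ∑ (λ i → f i * c) ≡ ∑ f * c
∑-*ʳ c f = trans (∑-cong (λ i → *-comm (f i) c)) (trans (∑-*ˡ c f) (*-comm c _))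

∑-zero : ∀ k → ∑ {k} (λ _ → 0) ≡ 0
∑-zero zero = refl
∑-zero (suc k) = ∑-zero k

∑-comm : ∀ {k l} (f : Fin k → Fin l → ℕ) → ∑ (λ i → ∑ (λ j → f i j)) ≡ ∑ (λ j → ∑ (λ i → f i j))
∑-comm {zero} {l} f = sym (∑-zero l)
∑-comm {suc k} f = trans (cong (∑ (f zero) +_) (∑-comm (λ i → f (suc i))))
  (sym (∑-distrib-+ (f zero) (λ j → ∑ (λ i → f (suc i) j))))

Vec≈ : ℕ → ∀ {n} → Vect n → Vect n → Set
Vec≈ d u v = ∀ t → u t ≈[ d ] v t

𝟘 : ∀ {n} → Vect n
𝟘 _ = 0

infixl 6 _+v_
infixl 7 _*v_

_+v_ : ∀ {n} → Vect n → Vect n → Vect n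
(u +v v) t = u t + v t

_*v_ : ∀ {n} → ℕ → Vect n → Vect n
(c *v v) t = c * v t

lin : ∀ {k n} → (Fin k → ℕ) → Mat k n → Vect n
lin y A j = ∑ (λ i → y i * A i j)

lin-+ : ∀ {k n} (y y′ : Fin k → ℕ) (A : Mat k n) j → lin (y +v y′) A j ≡ lin y A j + lin y′ A j
lin-+ y y′ A j = trans (∑-cong (λ i → *-distribʳ-+ (A i j) (y i) (y′ i)))
  (∑-distrib-+ (λ i → y i * A i j) (λ i → y′ i * A i j))

lin-* : ∀ {k n} c (y : Fin k → ℕ) (A : Mat k n) j → lin (c *v y) A j ≡ c * lin y A j
lin-* c y A j = trans (∑-cong (λ i → *-assoc c (y i) (A i j))) (∑-*ˡ c (λ i → y i * A i j))

lin-+* : ∀ {k n} (y y′ : Fin k → ℕ) c (A : Mat k n) j → lin (y +v c *v y′) A j ≡ lin y A j + c * lin y′ A j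
lin-+* y y′ c A j = trans (lin-+ y (c *v y′) A j) (cong (lin y A j +_) (lin-* c y′ A j))

lin-𝟘 : ∀ {k n} (A : Mat k n) j → lin 𝟘 A j ≡ 0
lin-𝟘 {k} A j = ∑-zero k

lin-· : ∀ {k l n} (y : Fin k → ℕ) (A : Mat k l) (B : Mat l n) j → lin y (A · B) j ≡ lin (lin y A) B j
lin-· y A B j = begin
  ∑ (λ i → y i * ∑ (λ t → A i t * B t j))        ≡⟨ ∑-cong (λ i → sym (∑-*ˡ (y i) (λ t → A i t * B t j))) ⟩
  ∑ (λ i → ∑ (λ t → y i * (A i t * B t j)))      ≡⟨ ∑-comm (λ i t → y i * (A i t * B t j)) ⟩
  ∑ (λ t → ∑ (λ i → y i * (A i t * B t j)))      ≡⟨ ∑-cong (λ t → trans (∑-cong (λ i → sym (*-assoc (y i) (A i t) (B t j)))) (∑-*ʳ (B t j) (λ i → y i * A i t))) ⟩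
  ∑ (λ t → ∑ (λ i → y i * A i t) * B t j)        ∎
  where open ≡-Reasoning

lin-congˡ : ∀ {d k n} {y y′ : Fin k → ℕ} (A : Mat k n) → Vec≈ d y y′ → Vec≈ d (lin y A) (lin y′ A)
lin-congˡ A e j = ∑-cong≈ (λ i → *-congʳ (A i j) (e i))

lin-congʳ : ∀ {d k n} (y : Fin k → ℕ) {A A′ : Mat k n} → MatEq d A A′ → Vec≈ d (lin y A) (lin y A′)
lin-congʳ y e j = ∑-cong≈ (λ i → *-congˡ (y i) (e i j))

identity-suc : ∀ k (i j : Fin k) → identity (suc k) (suc i) (suc j) ≡ identity k i j
identity-suc k i j with i Data.Fin.≟ j
... | yes refl = refl
... | no _ = refl

identity-sym : ∀ k (i j : Fin k) → identity k i j ≡ identity k j i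
identity-sym (suc k) zero zero = refl
identity-sym (suc k) zero (suc j) = refl
identity-sym (suc k) (suc i) zero = refl
identity-sym (suc k) (suc i) (suc j) =
  trans (identity-suc k i j) (trans (identity-sym k i j) (sym (identity-suc k j i)))

lin-identity : ∀ {k} (y : Fin k → ℕ) j → lin y (identity k) j ≡ y j
lin-identity {suc k} y zero = begin
  y zero * 1 + ∑ (λ i → y (suc i) * 0)  ≡⟨ cong₂ _+_ (*-identityʳ (y zero)) (∑-cong (λ i → *-zeroʳ (y (suc i)))) ⟩
  y zero + ∑ {k} (λ _ → 0)              ≡⟨ cong (y zero +_) (∑-zero k) ⟩
  y zero + 0                            ≡⟨ +-identityʳ (y zero) ⟩
  y zero                                ∎
  where open ≡-Reasoning
lin-identity {suc k} y (suc j) = begin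
  y zero * 0 + ∑ (λ i → y (suc i) * identity (suc k) (suc i) (suc j))  ≡⟨ cong₂ _+_ (*-zeroʳ (y zero)) (∑-cong (λ i → cong (y (suc i) *_) (identity-suc k i j))) ⟩
  lin (tail y) (identity k) j                                         ≡⟨ lin-identity (tail y) j ⟩
  y (suc j)                                                           ∎
  where open ≡-Reasoning

lin-row : ∀ {k n} (i : Fin k) (A : Mat k n) j → lin (identity k i) A j ≡ A i j
lin-row {k} i A j = trans (∑-cong (λ t → trans (*-comm _ (A t j)) (cong (A t j *_) (identity-sym k i t))))
  (lin-identity (λ t → A t j) i)

row∈span : ∀ {d k n} (X : Mat k n) i → InSpan d X (X i)
row∈span X i = identity _ i , λ j → ≡⇒≈ (lin-row i X j)

span-resp : ∀ {d k n} (X : Mat k n) {u v} → Vec≈ d u v → InSpan d X u → InSpan d X v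
span-resp X e (c , h) = c , λ j → ≈-trans (h j) (e j)

span-+* : ∀ {d k n} (X : Mat k n) {u v} → InSpan d X u → InSpan d X v → ∀ c → InSpan d X (u +v c *v v)
span-+* X (a , ha) (b , hb) c = a +v c *v b , λ j → ≈-trans (≡⇒≈ (lin-+* a b c X j)) (+-cong (ha j) (*-congˡ c (hb j)))

span-+ : ∀ {d k n} (X : Mat k n) {u v} → InSpan d X u → InSpan d X v → InSpan d X (u +v v)
span-+ X {u} {v} u∈X v∈X = span-resp X (λ t → ≡⇒≈ (cong (u t +_) (*-identityˡ (v t)))) (span-+* X u∈X v∈X 1)

span-* : ∀ {d k n} (X : Mat k n) {v} c → InSpan d X v → InSpan d X (c *v v)
span-* X c (b , hb) = c *v b , λ j → ≈-trans (≡⇒≈ (lin-* c b X j)) (*-congˡ c (hb j))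

span-lin : ∀ {d k l n} (X : Mat k n) (G : Mat l n) → (∀ i → InSpan d X (G i)) → ∀ y → InSpan d X (lin y G)
span-lin X G G⊆X y = lin y coeffs , λ j → ≈-trans (≡⇒≈ (sym (lin-· y coeffs X j))) (lin-congʳ y (λ i → proj₂ (G⊆X i)) j)
  where
  coeffs : Mat _ _
  coeffs i = proj₁ (G⊆X i)

rows⇒⊆ : ∀ {d k l n} (G : Mat l n) (X : Mat k n) → (∀ i → InSpan d X (G i)) → G ⊆[ d ] X
rows⇒⊆ G X G⊆X v (c , h) = span-resp X h (span-lin X G G⊆X c)

span-coords : ∀ {d k n} (X : Mat k n) (F : Mat n k) → MatEq d (X · F) (identity k) →
  ∀ {v} → InSpan d X v → Vec≈ d v (lin (lin v F) X)
span-coords {d} X F XF {v} (c , h) j = ≈-trans (≈-sym (h j)) (lin-congˡ X c≈vF j)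
  where
  c≈vF : Vec≈ d c (lin v F)
  c≈vF t = ≈-trans (≡⇒≈ (sym (lin-identity c t))) (≈-trans (≈-sym (lin-congʳ c XF t))
    (≈-trans (≡⇒≈ (lin-· c X F t)) (lin-congˡ F h t)))

-- The right inverse of v ∷ P: column 0 is e_j minus its projection along P, the other columns are D.
∷-unimodular : ∀ {d} .{{_ : NonZero d}} {k n} (P : Mat k n) (D : Mat n k) → MatEq d (P · D) (identity k) →
  (v : Vect n) (j : Fin n) → Vec≈ d (lin v D) 𝟘 → v j ≈[ d ] 1 → Unimodular d (v ∷ P)
∷-unimodular {d} {k} {n} P D PD v j vD≈0 v[j]≈1 = E , inverse
  where
  E : Mat n (suc k)
  E t = (identity n t j + (d ∸ 1) * (D · P) t j) ∷ D t
  lin-E₀ : ∀ x → lin x E zero ≡ x j + (d ∸ 1) * lin (lin x D) P j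
  lin-E₀ x = begin
    ∑ (λ t → x t * (identity n t j + (d ∸ 1) * (D · P) t j))               ≡⟨ ∑-cong (λ t → expand (x t) _ (d ∸ 1) _) ⟩
    ∑ (λ t → x t * identity n t j + (d ∸ 1) * (x t * (D · P) t j))         ≡⟨ ∑-distrib-+ (λ t → x t * identity n t j) _ ⟩
    lin x (identity n) j + ∑ (λ t → (d ∸ 1) * (x t * (D · P) t j))          ≡⟨ cong₂ _+_ (lin-identity x j) (∑-*ˡ (d ∸ 1) (λ t → x t * (D · P) t j)) ⟩
    x j + (d ∸ 1) * lin x (D · P) j                                         ≡⟨ cong (λ z → x j + (d ∸ 1) * z) (lin-· x D P j) ⟩
    x j + (d ∸ 1) * lin (lin x D) P j                                       ∎
    where
    open ≡-Reasoning
    expand : ∀ a b c e → a * (b + c * e) ≡ a * b + c * (a * e)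
    expand = solve-∀
  inverse : MatEq d ((v ∷ P) · E) (identity (suc k))
  inverse zero zero = ≈-trans (≡⇒≈ (lin-E₀ v)) (≈-trans (+-cong v[j]≈1 (*-congˡ (d ∸ 1) (lin-congˡ P vD≈0 j)))
    (≡⇒≈ (trans (cong (λ z → 1 + (d ∸ 1) * z) (lin-𝟘 P j)) (cong suc (*-zeroʳ (d ∸ 1))))))
  inverse zero (suc i) = vD≈0 i
  inverse (suc i) zero = ≈-trans (≡⇒≈ (lin-E₀ (P i))) (≈-trans (+-cong ≈-refl (*-congˡ (d ∸ 1)
    (≈-trans (lin-congˡ P (PD i) j) (≡⇒≈ (lin-row i P j))))) (+-inverse d (P i j)))
  inverse (suc i) (suc i′) = ≈-trans (PD i i′) (≡⇒≈ (sym (identity-suc k i i′)))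

funToFin-cong : ∀ {m n} (f g : Fin m → Fin n) → (∀ i → f i ≡ g i) → funToFin f ≡ funToFin g
funToFin-cong {zero} f g e = refl
funToFin-cong {suc m} f g e = cong₂ combine (e zero) (funToFin-cong (tail f) (tail g) (λ i → e (suc i)))

digits : ∀ d k → Fin (d ^ k) → Vect k
digits d k i t = toℕ (finToFun {d} {k} i t)

digits-injective : ∀ d k .{{_ : NonZero d}} (i i′ : Fin (d ^ k)) → Vec≈ d (digits d k i) (digits d k i′) → i ≡ i′
digits-injective d k i i′ e = begin
  i                               ≡⟨ funToFin-finToFin {k} {d} i ⟨
  funToFin (finToFun {d} {k} i)   ≡⟨ funToFin-cong (finToFun {d} {k} i) (finToFun i′) same-digit ⟩
  funToFin (finToFun {d} {k} i′)  ≡⟨ funToFin-finToFin {k} {d} i′ ⟩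
  i′                              ∎
  where
  open ≡-Reasoning
  same-digit : ∀ t → finToFun {d} {k} i t ≡ finToFun i′ t
  same-digit t = toℕ-injective (≈-reduced⇒≡ (e t) (toℕ<n _) (toℕ<n _))

residues-injective⇒≤ : ∀ d .{{_ : NonZero d}} {N l} (f : Fin N → Vect l) →
  (∀ i i′ → Vec≈ d (f i) (f i′) → i ≡ i′) → N ≤ d ^ l
residues-injective⇒≤ d {N} {l} f f-inj = injective⇒≤ {f = code} code-injective
  where
  residue : Fin N → Fin l → Fin d
  residue i t = fromℕ< (m%n<n (f i t) d)
  code : Fin N → Fin (d ^ l)
  code i = funToFin (residue i)
  code-injective : ∀ {i i′} → code i ≡ code i′ → i ≡ i′
  code-injective {i} {i′} e = f-inj i i′ λ t → %≡⇒≈ (begin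
    f i t % d                   ≡⟨ toℕ-fromℕ< _ ⟨
    toℕ (residue i t)           ≡⟨ cong toℕ (finToFun-funToFin (residue i) t) ⟨
    toℕ (finToFun (code i) t)   ≡⟨ cong (λ c → toℕ (finToFun c t)) e ⟩
    toℕ (finToFun (code i′) t)  ≡⟨ cong toℕ (finToFun-funToFin (residue i′) t) ⟩
    toℕ (residue i′ t)          ≡⟨ toℕ-fromℕ< _ ⟩
    f i′ t % d                  ∎)
    where open ≡-Reasoning

unimodular⇒≤ : ∀ {d k l} → 1 < d → (A : Mat k l) (B : Mat l k) → MatEq d (A · B) (identity k) → k ≤ l
unimodular⇒≤ {suc d} {k} {l} 1<d A B AB = ≮⇒≥ λ l<k →
  <⇒≱ (^-monoʳ-< (suc d) 1<d l<k) (residues-injective⇒≤ (suc d) (λ i → lin (digits (suc d) k i) A) injective)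
  where
  undo : ∀ y t → lin (lin y A) B t ≈[ suc d ] y t
  undo y t = ≈-trans (≡⇒≈ (sym (lin-· y A B t))) (≈-trans (lin-congʳ y AB t) (≡⇒≈ (lin-identity y t)))
  injective : ∀ i i′ → Vec≈ (suc d) (lin (digits (suc d) k i) A) (lin (digits (suc d) k i′) A) → i ≡ i′
  injective i i′ e = digits-injective (suc d) k i i′ λ t →
    ≈-trans (≈-sym (undo (digits (suc d) k i) t)) (≈-trans (lin-congˡ B e t) (undo (digits (suc d) k i′) t))

unimodular-in-span⇒≤ : ∀ {d k g n} → 1 < d → (X : Mat k n) (F : Mat n k) → MatEq d (X · F) (identity k) →
  (G : Mat g n) (Y : Mat k g) → (∀ i t → X i t ≈[ d ] lin (Y i) G t) → k ≤ g
unimodular-in-span⇒≤ 1<d X F XF G Y X≈YG = unimodular⇒≤ 1<d Y (G · F) λ i t →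
  ≈-trans (≡⇒≈ (lin-· (Y i) G F t)) (≈-trans (lin-congˡ F (λ t′ → ≈-sym (X≈YG i t′)) t) (XF i t))

span-injective⇒≤ : ∀ {d} .{{_ : NonZero d}} {k n N} (X : Mat k n) (F : Mat n k) → MatEq d (X · F) (identity k) →
  (f : Fin N → Vect n) → (∀ i → InSpan d X (f i)) → (∀ i i′ → Vec≈ d (f i) (f i′) → i ≡ i′) → N ≤ d ^ k
span-injective⇒≤ {d} X F XF f f∈X f-inj = residues-injective⇒≤ d (λ i → lin (f i) F) λ i i′ e → f-inj i i′ λ t →
  ≈-trans (span-coords X F XF (f∈X i) t) (≈-trans (lin-congˡ X e t) (≈-sym (span-coords X F XF (f∈X i′) t)))

-- No z in the span of X lies outside the span of k independent vectors G of it: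
-- otherwise the vectors y G and y G + z would be 2 d ^ k distinct residues in the span of X.
independent-rows-span : ∀ {d} .{{_ : NonZero d}} {k n} (X : Mat k n) (F : Mat n k) → MatEq d (X · F) (identity k) →
  (G : Mat k n) → (∀ i → InSpan d X (G i)) → (∀ y y′ → Vec≈ d (lin y G) (lin y′ G) → Vec≈ d y y′) →
  ∀ {z} → InSpan d X z → ¬ (∀ y y′ → ¬ Vec≈ d (lin y G +v z) (lin y′ G))
independent-rows-span {d} {k} X F XF G G⊆X G-indep {z} z∈X z-outside =
  <⇒≱ (m<m+n (d ^ k) (m^n>0 d k)) (span-injective⇒≤ X F XF (vec ∘ splitAt (d ^ k)) vec∈X vec-injective)
  where
  vec : Fin (d ^ k) ⊎ Fin (d ^ k) → Vect _
  vec (inj₁ a) = lin (digits d k a) G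
  vec (inj₂ a) = lin (digits d k a) G +v z
  vec∈X : ∀ i → InSpan d X (vec (splitAt (d ^ k) i))
  vec∈X i with splitAt (d ^ k) i
  ... | inj₁ a = span-lin X G G⊆X (digits d k a)
  ... | inj₂ a = span-+ X (span-lin X G G⊆X (digits d k a)) z∈X
  vec-inj : ∀ x x′ → Vec≈ d (vec x) (vec x′) → x ≡ x′
  vec-inj (inj₁ a) (inj₁ a′) e = cong inj₁ (digits-injective d k a a′ (G-indep (digits d k a) (digits d k a′) e))
  vec-inj (inj₂ a) (inj₂ a′) e = cong inj₂ (digits-injective d k a a′ (G-indep (digits d k a) (digits d k a′) λ t →
    +-cancelˡ-≈ (≈-refl {x = z t}) (≈-trans (≡⇒≈ (+-comm (z t) _)) (≈-trans (e t) (≡⇒≈ (+-comm _ (z t)))))))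
  vec-inj (inj₂ a) (inj₁ a′) e = ⊥-elim (z-outside (digits d k a) (digits d k a′) e)
  vec-inj (inj₁ a) (inj₂ a′) e = ⊥-elim (z-outside (digits d k a′) (digits d k a) λ t → ≈-sym (e t))
  vec-injective : ∀ i i′ → Vec≈ d (vec (splitAt (d ^ k) i)) (vec (splitAt (d ^ k) i′)) → i ≡ i′
  vec-injective i i′ e = begin
    i                                         ≡⟨ join-splitAt (d ^ k) (d ^ k) i ⟨
    join (d ^ k) (d ^ k) (splitAt (d ^ k) i)  ≡⟨ cong (join (d ^ k) (d ^ k)) (vec-inj (splitAt (d ^ k) i) (splitAt (d ^ k) i′) e) ⟩
    join (d ^ k) (d ^ k) (splitAt (d ^ k) i′) ≡⟨ join-splitAt (d ^ k) (d ^ k) i′ ⟩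
    i′                                        ∎
    where open ≡-Reasoning

¬∣⇒coprime : ∀ {p x} → Prime p → ¬ (p ∣ x) → Coprime x p
¬∣⇒coprime pp p∤x {i} (i∣x , i∣p) with prime⇒irreducible pp i∣p
... | inj₁ i≡1 = i≡1
... | inj₂ refl = ⊥-elim (p∤x i∣x)

coprime-* : ∀ {x a b} → Coprime x a → Coprime x b → Coprime x (a * b)
coprime-* {x} {a} coprime-a coprime-b {i} (i∣x , i∣ab) = coprime-b (i∣x , coprime-divisor i⊥a i∣ab)
  where
  i⊥a : Coprime i a
  i⊥a (j∣i , j∣a) = coprime-a (∣-trans j∣i i∣x , j∣a)

coprime-^ : ∀ {p x} → Prime p → ¬ (p ∣ x) → ∀ s → Coprime x (p ^ s)
coprime-^ pp p∤x zero (_ , i∣1) = ∣1⇒≡1 i∣1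
coprime-^ pp p∤x (suc s) = coprime-* (¬∣⇒coprime pp p∤x) (coprime-^ pp p∤x s)

unit-inverse : ∀ {p x} → Prime p → ¬ (p ∣ x) → ∀ s → ∃ λ ι → (ι * x) ≈[ p ^ s ] 1
unit-inverse {p} {x} pp p∤x s with coprime-Bézout (coprime-^ pp p∤x s)
... | Bézout.+- ι y eq = ι , 0 , y , trans (+-identityʳ _) (sym eq)
... | Bézout.-+ ι y eq = (p ^ s ∸ 1) * ι , (begin
  (p ^ s ∸ 1) * ι * x                     ≡⟨ regroup (p ^ s ∸ 1) ι x ⟩
  (p ^ s ∸ 1) * (ι * x) + 0               ≈⟨ +-cong ≈-refl ιx≈-1 ⟨
  (p ^ s ∸ 1) * (ι * x) + (1 + ι * x)     ≡⟨ rotate (p ^ s ∸ 1) (ι * x) ⟩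
  1 + (ι * x + (p ^ s ∸ 1) * (ι * x))     ≈⟨ +-cong ≈-refl (+-inverse (p ^ s) (ι * x)) ⟩
  1 + 0                                   ≡⟨⟩
  1                                       ∎)
  where
  instance
    _ = m^n≢0 p s {{prime⇒nonZero pp}}
  open ≈-Reasoning (p ^ s)
  ιx≈-1 : (1 + ι * x) ≈[ p ^ s ] 0
  ιx≈-1 = 0 , y , trans (+-identityʳ _) eq
  regroup : ∀ a b c → a * b * c ≡ a * (b * c) + 0
  regroup = solve-∀
  rotate : ∀ a b → a * b + (1 + b) ≡ 1 + (b + a * b)
  rotate = solve-∀

¬∀∀⇒∃∃¬ : ∀ {k l} (R : Fin k → Fin l → Set) → (∀ i t → Dec (R i t)) → ¬ (∀ i t → R i t) → ∃₂ λ i t → ¬ R i t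
¬∀∀⇒∃∃¬ {k} {l} R R? ¬all with ¬∀⟶∃¬ k (λ i → ∀ t → R i t) (λ i → all? (R? i)) ¬all
... | i , ¬row = i , ¬∀⟶∃¬ l (R i) (R? i) ¬row

HasCard-++ : ∀ {d m n a b} {S : Mat m n → Set} (A : Fin a → Mat m n) (B : Fin b → Mat m n) →
  (∀ i → S (A i)) → (∀ i → S (B i)) →
  (∀ i i′ → SameSpan d (A i) (A i′) → i ≡ i′) → (∀ i i′ → SameSpan d (B i) (B i′) → i ≡ i′) →
  (∀ i i′ → ¬ SameSpan d (A i) (B i′)) →
  (∀ X → S X → (∃ λ i → SameSpan d X (A i)) ⊎ (∃ λ i → SameSpan d X (B i))) →
  HasCard d S (a + b)
HasCard-++ {d} {a = a} {b} {S} A B A∈S B∈S A-inj B-inj A≁B spans-Xa = L , L∈S , L-distinct , L-cover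
  where
  A⊎B : Fin a ⊎ Fin b → Mat _ _
  A⊎B = [ A , B ]′
  L : Fin (a + b) → Mat _ _
  L i = A⊎B (splitAt a i)
  L∈S : ∀ i → S (L i)
  L∈S i with splitAt a i
  ... | inj₁ x = A∈S x
  ... | inj₂ y = B∈S y
  A⊎B-inj : ∀ x y → SameSpan d (A⊎B x) (A⊎B y) → x ≡ y
  A⊎B-inj (inj₁ i) (inj₁ i′) ss = cong inj₁ (A-inj i i′ ss)
  A⊎B-inj (inj₂ i) (inj₂ i′) ss = cong inj₂ (B-inj i i′ ss)
  A⊎B-inj (inj₁ i) (inj₂ i′) ss = ⊥-elim (A≁B i i′ ss)
  A⊎B-inj (inj₂ i) (inj₁ i′) ss = ⊥-elim (A≁B i′ i (swap ss))
  L-distinct : ∀ i i′ → i ≢ i′ → ¬ SameSpan d (L i) (L i′)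
  L-distinct i i′ i≢i′ ss = i≢i′ (begin
    i                           ≡⟨ join-splitAt a b i ⟨
    join a b (splitAt a i)      ≡⟨ cong (join a b) (A⊎B-inj (splitAt a i) (splitAt a i′) ss) ⟩
    join a b (splitAt a i′)     ≡⟨ join-splitAt a b i′ ⟩
    i′                          ∎)
    where open ≡-Reasoning
  L-cover : ∀ X → S X → ∃ λ i → SameSpan d X (L i)
  L-cover X X∈S with spans-Xa X X∈S
  ... | inj₁ (i , ss) = i ↑ˡ b , subst (SameSpan d X) (cong A⊎B (sym (splitAt-↑ˡ a i b))) ss
  ... | inj₂ (i , ss) = a ↑ʳ i , subst (SameSpan d X) (cong A⊎B (sym (splitAt-↑ʳ a b i))) ss

module PrimePower (p s′ : ℕ) (pp : Prime p) where

  r q ν : ℕ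
  r = p ^ s′
  q = p * r
  ν = q ∸ 1

  instance
    p≢0 : NonZero p
    p≢0 = prime⇒nonZero pp
    r≢0 : NonZero r
    r≢0 = m^n≢0 p s′
    q≢0 : NonZero q
    q≢0 = m^n≢0 p (suc s′)

  1<p : 1 < p
  1<p = nonTrivial⇒n>1 p {{prime⇒nonTrivial pp}}

  mod-p : ∀ {x y} → x ≈[ q ] y → x ≈[ p ] y
  mod-p = ≈-weaken r

  ν-inverse : ∀ x → (x + ν * x) ≈[ q ] 0
  ν-inverse = +-inverse q

  infixl 6 _⊖_
  _⊖_ : ∀ {n} → Vect n → Vect n → Vect n
  v ⊖ w = v +v ν *v w

  ⊖-split : ∀ {n} (v w : Vect n) t → v t ≈[ q ] ((v ⊖ w) t + w t)
  ⊖-split v w t = ≈-sym (+-inverse-absorb q (v t) (w t))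

  p*-cancel : ∀ {b b′} → (p * b) ≈[ q ] (p * b′) → b ≈[ r ] b′
  p*-cancel {b} {b′} (x , y , e) = x , y , *-cancelˡ-≡ (b + x * r) (b′ + y * r) p
    (trans (distribute p b x r) (trans e (sym (distribute p b′ y r))))
    where
    distribute : ∀ p b x r → p * (b + x * r) ≡ p * b + x * (p * r)
    distribute = solve-∀

  p*[t%r]≈t*p : ∀ t → (p * (t % r)) ≈[ q ] (t * p)
  p*[t%r]≈t*p t = t / r , 0 , (begin
    p * (t % r) + t / r * (p * r)  ≡⟨ regroup p (t % r) (t / r) r ⟩
    (t % r + t / r * r) * p        ≡⟨ cong (_* p) (m≡m%n+[m/n]*n t r) ⟨
    t * p                          ≡⟨ +-identityʳ (t * p) ⟨
    t * p + 0                      ∎)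
    where
    open ≡-Reasoning
    regroup : ∀ p a b r → p * a + b * (p * r) ≡ (a + b * r) * p
    regroup = solve-∀

  p-multiple≉1 : ∀ x → p ∣ x → ¬ (x ≈[ q ] 1)
  p-multiple≉1 x p∣x x≈1 with ≈-reduced⇒≡ (≈-trans (≈-sym (mod-p x≈1)) (∣⇒≈0 p∣x)) 1<p (<-trans z<s 1<p)
  ... | ()

  module Between {m′ n : ℕ}
    (P : Mat m′ n) (D : Mat n m′) (PD : MatEq q (P · D) (identity m′))
    (Q : Mat (suc (suc m′)) n) (C : Mat n (suc (suc m′))) (QC : MatEq q (Q · C) (identity (suc (suc m′))))
    (P⊆Q : P ⊆[ q ] Q) where

    P-row∈Q : ∀ k → InSpan q Q (P k)
    P-row∈Q k = P⊆Q (P k) (row∈span P k)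

    lin-P-D : ∀ y k → lin (lin y P) D k ≈[ q ] y k
    lin-P-D y k = ≈-trans (≡⇒≈ (sym (lin-· y P D k))) (≈-trans (lin-congʳ y PD k) (≡⇒≈ (lin-identity y k)))

    Q∩kerD : Vect n → Set
    Q∩kerD v = InSpan q Q v × Vec≈ q (lin v D) 𝟘

    Q∩kerD-+* : ∀ {v x} → Q∩kerD v → Q∩kerD x → ∀ c → Q∩kerD (v +v c *v x)
    Q∩kerD-+* {v} {x} (v∈Q , vD≈0) (x∈Q , xD≈0) c = span-+* Q v∈Q x∈Q c , λ k →
      ≈-trans (≡⇒≈ (lin-+* v x c D k)) (≈-trans (+-cong (vD≈0 k) (*-congˡ c (xD≈0 k))) (≡⇒≈ (*-zeroʳ c)))

    Q∩kerD-* : ∀ {v} c → Q∩kerD v → Q∩kerD (c *v v)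
    Q∩kerD-* {v} c (v∈Q , vD≈0) = span-* Q c v∈Q , λ k →
      ≈-trans (≡⇒≈ (lin-* c v D k)) (≈-trans (*-congˡ c (vD≈0 k)) (≡⇒≈ (*-zeroʳ c)))

    proj : Vect n → Vect n
    proj v = v ⊖ lin (lin v D) P

    proj-Q∩kerD : ∀ {v} → InSpan q Q v → Q∩kerD (proj v)
    proj-Q∩kerD {v} v∈Q = span-+* Q v∈Q (span-lin Q P P-row∈Q (lin v D)) ν , λ k →
      ≈-trans (≡⇒≈ (lin-+* v (lin (lin v D) P) ν D k))
        (≈-trans (+-cong ≈-refl (*-congˡ ν (lin-P-D (lin v D) k))) (ν-inverse (lin v D k)))

    eliminate : Vect n → Fin n → Vect n → Vect n
    eliminate x t v = v ⊖ v t *v x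

    eliminate-Q∩kerD : ∀ x t v → Q∩kerD x → Q∩kerD v → Q∩kerD (eliminate x t v)
    eliminate-Q∩kerD x t v x∈ v∈ = Q∩kerD-+* v∈ (Q∩kerD-* (v t) x∈) ν

    eliminate-at : ∀ x t v → x t ≈[ q ] 1 → eliminate x t v t ≈[ q ] 0
    eliminate-at x t v x[t]≈1 =
      ≈-trans (+-cong ≈-refl (*-congˡ ν (≈-trans (*-congˡ (v t) x[t]≈1) (≡⇒≈ (*-identityʳ (v t)))))) (ν-inverse (v t))

    eliminate-off : ∀ x t {t′} v → x t′ ≈[ q ] 0 → eliminate x t v t′ ≈[ q ] v t′
    eliminate-off x t {t′} v x[t′]≈0 =
      ≈-trans (+-cong ≈-refl (*-congˡ ν (*-congˡ (v t) x[t′]≈0))) (≡⇒≈ (vanish (v t′) ν (v t)))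
      where
      vanish : ∀ a ν b → a + ν * (b * 0) ≡ a
      vanish = solve-∀

    -- If every entry of R were divisible by p, the m′ + 2 rows of Q would lie mod p in the span of the g rows of G.
    unit-entry : ∀ {g} (R : Fin (suc (suc m′)) → Vect n) (Y : Mat (suc (suc m′)) g) (G : Mat g n) →
      g < suc (suc m′) → (∀ i t → Q i t ≈[ q ] (R i t + lin (Y i) G t)) → ∃₂ λ i t → ¬ (p ∣ R i t)
    unit-entry R Y G g<2+m′ Q≈R+YG = ¬∀∀⇒∃∃¬ (λ i t → p ∣ R i t) (λ i t → p ∣? R i t) λ p∣R →
      <⇒≱ g<2+m′ (unimodular-in-span⇒≤ 1<p Q C (λ i t → mod-p (QC i t)) G Y λ i t →
        ≈-trans (mod-p (Q≈R+YG i t)) (+-cong (∣⇒≈0 (p∣R i t)) ≈-refl))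

    record Frame : Set where
      field
        u w : Vect n
        j j′ : Fin n
        u∈ : Q∩kerD u
        w∈ : Q∩kerD w
        u[j]≈1 : u j ≈[ q ] 1
        u[j′]≈0 : u j′ ≈[ q ] 0
        w[j]≈0 : w j ≈[ q ] 0
        w[j′]≈1 : w j′ ≈[ q ] 1

    swapped : Frame → Frame
    swapped F = record
      { u = w ; w = u ; j = j′ ; j′ = j ; u∈ = w∈ ; w∈ = u∈
      ; u[j]≈1 = w[j′]≈1 ; u[j′]≈0 = w[j]≈0 ; w[j]≈0 = u[j′]≈0 ; w[j′]≈1 = u[j]≈1 }
      where open Frame F

    -- Clearing column j from the projected rows of Q leaves an entry j′ prime to p (otherwise Q would lie
    -- mod p in the span of u₁ and P); scaling that row gives w, and clearing column j′ from u₁ gives u.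
    frame-from : (u₁ : Vect n) (j : Fin n) → Q∩kerD u₁ → u₁ j ≈[ q ] 1 → Frame
    frame-from u₁ j u₁∈ u₁[j]≈1 = complete (unit-entry R Y (u₁ ∷ P) (n<1+n (suc m′)) Q≈R+Y[u₁∷P])
      where
      R : Fin (suc (suc m′)) → Vect n
      R k = eliminate u₁ j (proj (Q k))
      Y : Mat (suc (suc m′)) (suc m′)
      Y k = proj (Q k) j ∷ lin (Q k) D
      Q≈R+Y[u₁∷P] : ∀ k t → Q k t ≈[ q ] (R k t + lin (Y k) (u₁ ∷ P) t)
      Q≈R+Y[u₁∷P] k t = ≈-trans (⊖-split (Q k) (lin (lin (Q k) D) P) t)
        (≈-trans (+-cong (⊖-split (proj (Q k)) (proj (Q k) j *v u₁) t) ≈-refl) (≡⇒≈ (+-assoc (R k t) _ _)))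
      complete : (∃₂ λ k j′ → ¬ (p ∣ R k j′)) → Frame
      complete (k , j′ , p∤R) = record
        { u = eliminate w j′ u₁ ; w = w ; j = j ; j′ = j′
        ; u∈ = eliminate-Q∩kerD w j′ u₁ w∈ u₁∈
        ; w∈ = w∈
        ; u[j]≈1 = ≈-trans (eliminate-off w j′ u₁ w[j]≈0) u₁[j]≈1
        ; u[j′]≈0 = eliminate-at w j′ u₁ w[j′]≈1
        ; w[j]≈0 = w[j]≈0
        ; w[j′]≈1 = w[j′]≈1
        }
        where
        ι : ℕ
        ι = proj₁ (unit-inverse pp p∤R (suc s′))
        w : Vect n
        w = ι *v R k
        w∈ : Q∩kerD w
        w∈ = Q∩kerD-* ι (eliminate-Q∩kerD u₁ j (proj (Q k)) u₁∈ (proj-Q∩kerD (row∈span Q k)))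
        w[j]≈0 : w j ≈[ q ] 0
        w[j]≈0 = ≈-trans (*-congˡ ι (eliminate-at u₁ j (proj (Q k)) u₁[j]≈1)) (≡⇒≈ (*-zeroʳ ι))
        w[j′]≈1 : w j′ ≈[ q ] 1
        w[j′]≈1 = proj₂ (unit-inverse pp p∤R (suc s′))

    -- Abstract, so that conversion checking never unfolds the divisibility searches and Bézout inverses in it.
    abstract
      frame : Frame
      frame = start (unit-entry (λ i → proj (Q i)) (λ i → lin (Q i) D) P (m<n⇒m<1+n (n<1+n m′))
        λ i → ⊖-split (Q i) (lin (lin (Q i) D) P))
        where
        start : (∃₂ λ i j → ¬ (p ∣ proj (Q i) j)) → Frame
        start (i , j , p∤) with unit-inverse pp p∤ (suc s′)
        ... | ι , ι[ij]≈1 = frame-from (ι *v proj (Q i)) j (Q∩kerD-* ι (proj-Q∩kerD (row∈span Q i))) ι[ij]≈1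

    module Coordinates (F : Frame) where
      open Frame F

      comb : (Fin m′ → ℕ) → ℕ → ℕ → Vect n
      comb y α β = lin y P +v α *v u +v β *v w

      comb∈Q : ∀ y α β → InSpan q Q (comb y α β)
      comb∈Q y α β = span-+* Q (span-+* Q (span-lin Q P P-row∈Q y) (proj₁ u∈) α) (proj₁ w∈) β

      comb-D : ∀ y α β k → lin (comb y α β) D k ≈[ q ] y k
      comb-D y α β k = begin
        lin (comb y α β) D k                               ≡⟨ trans (lin-+* (lin y P +v α *v u) w β D k) (cong (_+ β * lin w D k) (lin-+* (lin y P) u α D k)) ⟩
        lin (lin y P) D k + α * lin u D k + β * lin w D k  ≈⟨ +-cong (+-cong (lin-P-D y k) (*-congˡ α (proj₂ u∈ k))) (*-congˡ β (proj₂ w∈ k)) ⟩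
        y k + α * 0 + β * 0                                ≡⟨ vanish (y k) α β ⟩
        y k                                                ∎
        where
        open ≈-Reasoning q
        vanish : ∀ a b c → a + b * 0 + c * 0 ≡ a
        vanish = solve-∀

      comb-j : ∀ y α β → comb y α β j ≈[ q ] (lin y P j + α)
      comb-j y α β = ≈-trans (+-cong (+-cong ≈-refl (*-congˡ α u[j]≈1)) (*-congˡ β w[j]≈0)) (≡⇒≈ (simplify (lin y P j) α β))
        where
        simplify : ∀ a b c → a + b * 1 + c * 0 ≡ a + b
        simplify = solve-∀

      comb-j′ : ∀ y α β → comb y α β j′ ≈[ q ] (lin y P j′ + β)
      comb-j′ y α β = ≈-trans (+-cong (+-cong ≈-refl (*-congˡ α u[j′]≈0)) (*-congˡ β w[j′]≈1)) (≡⇒≈ (simplify (lin y P j′) α β))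
        where
        simplify : ∀ a b c → a + b * 0 + c * 1 ≡ a + c
        simplify = solve-∀

      record SameCoords (V V′ : Vect n) : Set where
        constructor coords≈
        field
          D≈ : Vec≈ q (lin V D) (lin V′ D)
          j≈ : V j ≈[ q ] V′ j
          j′≈ : V j′ ≈[ q ] V′ j′

      ≈⇒SameCoords : ∀ {V V′} → Vec≈ q V V′ → SameCoords V V′
      ≈⇒SameCoords V≈V′ = coords≈ (lin-congˡ D V≈V′) (V≈V′ j) (V≈V′ j′)

      SameCoords-trans : ∀ {V V′ V″} → SameCoords V V′ → SameCoords V′ V″ → SameCoords V V″
      SameCoords-trans (coords≈ D≈ j≈ j′≈) (coords≈ D≈′ j≈′ j′≈′) =
        coords≈ (λ k → ≈-trans (D≈ k) (D≈′ k)) (≈-trans j≈ j≈′) (≈-trans j′≈ j′≈′)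

      comb-injective : ∀ {y α β y′ α′ β′} → SameCoords (comb y α β) (comb y′ α′ β′) →
        Vec≈ q y y′ × α ≈[ q ] α′ × β ≈[ q ] β′
      comb-injective {y} {α} {β} {y′} {α′} {β′} (coords≈ D≈ j≈ j′≈) = y≈y′ ,
        +-cancelˡ-≈ (lin-congˡ P y≈y′ j) (≈-trans (≈-sym (comb-j y α β)) (≈-trans j≈ (comb-j y′ α′ β′))) ,
        +-cancelˡ-≈ (lin-congˡ P y≈y′ j′) (≈-trans (≈-sym (comb-j′ y α β)) (≈-trans j′≈ (comb-j′ y′ α′ β′)))
        where
        y≈y′ : Vec≈ q y y′
        y≈y′ k = ≈-trans (≈-sym (comb-D y α β k)) (≈-trans (D≈ k) (comb-D y′ α′ β′ k))

      basis : Mat (suc (suc m′)) n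
      basis = u ∷ w ∷ P

      lin-basis : ∀ y t → lin y basis t ≡ comb (tail (tail y)) (y zero) (y (suc zero)) t
      lin-basis y t = rotate (y zero * u t) (y (suc zero) * w t) (lin (tail (tail y)) P t)
        where
        rotate : ∀ a b c → a + (b + c) ≡ c + a + b
        rotate = solve-∀

      basis-injective : ∀ y y′ → SameCoords (lin y basis) (lin y′ basis) → Vec≈ q y y′
      basis-injective y y′ y≈ᶜy′ = assemble (comb-injective (SameCoords-trans from-comb (SameCoords-trans y≈ᶜy′ to-comb)))
        where
        from-comb : SameCoords (comb (tail (tail y)) (y zero) (y (suc zero))) (lin y basis)
        from-comb = ≈⇒SameCoords (λ t → ≡⇒≈ (sym (lin-basis y t)))
        to-comb : SameCoords (lin y′ basis) (comb (tail (tail y′)) (y′ zero) (y′ (suc zero)))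
        to-comb = ≈⇒SameCoords (λ t → ≡⇒≈ (lin-basis y′ t))
        assemble : Vec≈ q (tail (tail y)) (tail (tail y′)) × y zero ≈[ q ] y′ zero × y (suc zero) ≈[ q ] y′ (suc zero) →
          Vec≈ q y y′
        assemble (_ , y₀≈ , _) zero = y₀≈
        assemble (_ , _ , y₁≈) (suc zero) = y₁≈
        assemble (rest≈ , _ , _) (suc (suc k)) = rest≈ k

      basis∈Q : ∀ i → InSpan q Q (basis i)
      basis∈Q zero = proj₁ u∈
      basis∈Q (suc zero) = proj₁ w∈
      basis∈Q (suc (suc k)) = P-row∈Q k

      coords-zero⇒≈0 : ∀ {z} → InSpan q Q z → Vec≈ q (lin z D) 𝟘 → z j ≈[ q ] 0 → z j′ ≈[ q ] 0 → Vec≈ q z 𝟘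
      coords-zero⇒≈0 {z} z∈Q zD≈0 z[j]≈0 z[j′]≈0 t = decidable-stable (≈? q (z t) 0) λ z[t]≉0 →
        independent-rows-span Q C QC basis basis∈Q (λ y y′ e → basis-injective y y′ (≈⇒SameCoords e)) z∈Q λ y y′ e →
          z[t]≉0 (+-cancelˡ-≈ ≈-refl (≈-trans (e t) (≈-trans
            (lin-congˡ basis (λ i → ≈-sym (basis-injective y y′ (SameCoords-trans (invisible y) (≈⇒SameCoords e)) i)) t)
            (≡⇒≈ (sym (+-identityʳ _))))))
        where
        invisible : ∀ y → SameCoords (lin y basis) (lin y basis +v z)
        invisible y = coords≈
          (λ k → ≈-sym (≈-trans (≡⇒≈ (lin-+ (lin y basis) z D k)) (≈-trans (+-cong ≈-refl (zD≈0 k)) (≡⇒≈ (+-identityʳ _)))))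
          (≈-sym (≈-trans (+-cong ≈-refl z[j]≈0) (≡⇒≈ (+-identityʳ _))))
          (≈-sym (≈-trans (+-cong ≈-refl z[j′]≈0) (≡⇒≈ (+-identityʳ _))))

      SameCoords⇒≈ : ∀ {V V′} → InSpan q Q V → InSpan q Q V′ → SameCoords V V′ → Vec≈ q V V′
      SameCoords⇒≈ {V} {V′} V∈Q V′∈Q (coords≈ D≈ j≈ j′≈) t = ≈-move (coords-zero⇒≈0 (span-+* Q V∈Q V′∈Q ν)
        (λ k → ≈-trans (≡⇒≈ (lin-+* V V′ ν D k)) (difference (D≈ k))) (difference j≈) (difference j′≈) t)
        where
        difference : ∀ {a b} → a ≈[ q ] b → (a + ν * b) ≈[ q ] 0
        difference {b = b} a≈b = ≈-trans (+-cong a≈b ≈-refl) (ν-inverse b)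

      decompose : ∀ {V} → InSpan q Q V → Vec≈ q V (comb (lin V D) (proj V j) (proj V j′))
      decompose {V} V∈Q = SameCoords⇒≈ V∈Q (comb∈Q (lin V D) (proj V j) (proj V j′)) (coords≈
        (λ k → ≈-sym (comb-D (lin V D) (proj V j) (proj V j′) k))
        (recover j (comb-j (lin V D) (proj V j) (proj V j′)))
        (recover j′ (comb-j′ (lin V D) (proj V j) (proj V j′))))
        where
        recover : ∀ {c} t → c ≈[ q ] (lin (lin V D) P t + proj V t) → V t ≈[ q ] c
        recover t c≈ = ≈-sym (≈-trans c≈ (≈-trans (≡⇒≈ (+-comm _ (proj V t))) (+-inverse-absorb q (V t) _)))

      Xa : ℕ → Mat (suc m′) n
      Xa a = (u +v a *v w) ∷ P

      Xb : ℕ → Mat (suc m′) n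
      Xb c = (w +v c *v u) ∷ P

      lin-Xa : ∀ a y t → lin y (Xa a) t ≡ comb (tail y) (y zero) (y zero * a) t
      lin-Xa a y t = expand (y zero) (u t) a (w t) (lin (tail y) P t)
        where
        expand : ∀ y₀ x a z L → y₀ * (x + a * z) + L ≡ L + y₀ * x + y₀ * a * z
        expand = solve-∀

      lin-Xb : ∀ c y t → lin y (Xb c) t ≡ comb (tail y) (y zero * c) (y zero) t
      lin-Xb c y t = expand (y zero) (w t) c (u t) (lin (tail y) P t)
        where
        expand : ∀ y₀ z c x L → y₀ * (z + c * x) + L ≡ L + y₀ * c * x + y₀ * z
        expand = solve-∀

      lead≡comb : ∀ a t → (u +v a *v w) t ≡ comb 𝟘 1 a t
      lead≡comb a t = sym (trans (cong (λ z → z + 1 * u t + a * w t) (lin-𝟘 P t)) (cong (_+ a * w t) (*-identityˡ (u t))))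

      Xa∈ : ∀ a → InStarTop q P Q (Xa a)
      Xa∈ a = ∷-unimodular P D PD (u +v a *v w) j (proj₂ lead∈) lead[j]≈1 ,
              rows⇒⊆ P (Xa a) (λ k → row∈span (Xa a) (suc k)) , rows⇒⊆ (Xa a) Q rows∈Q
        where
        lead∈ : Q∩kerD (u +v a *v w)
        lead∈ = Q∩kerD-+* u∈ w∈ a
        lead[j]≈1 : (u j + a * w j) ≈[ q ] 1
        lead[j]≈1 = ≈-trans (+-cong u[j]≈1 (*-congˡ a w[j]≈0)) (≡⇒≈ (cong (1 +_) (*-zeroʳ a)))
        rows∈Q : ∀ i → InSpan q Q (Xa a i)
        rows∈Q zero = proj₁ lead∈
        rows∈Q (suc k) = P-row∈Q k

      Xa-injective : ∀ a a′ → Xa a ⊆[ q ] Xa a′ → a ≈[ q ] a′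
      Xa-injective a a′ Xa⊆Xa′ = conclude (Xa⊆Xa′ (u +v a *v w) (row∈span (Xa a) zero))
        where
        conclude : InSpan q (Xa a′) (u +v a *v w) → a ≈[ q ] a′
        conclude (c , c≈lead) =
          ≈-trans (≈-sym (proj₂ (proj₂ coeffs))) (≈-trans (*-congʳ a′ (proj₁ (proj₂ coeffs))) (≡⇒≈ (+-identityʳ a′)))
          where
          coeffs = comb-injective {tail c} {c zero} {c zero * a′} {𝟘} {1} {a}
            (≈⇒SameCoords λ t → ≈-trans (≡⇒≈ (sym (lin-Xa a′ c t))) (≈-trans (c≈lead t) (≡⇒≈ (lead≡comb a t))))

      Xa-independent : ∀ a y y′ → Vec≈ q (lin y (Xa a)) (lin y′ (Xa a)) → Vec≈ q y y′
      Xa-independent a y y′ e = assemble (comb-injective {tail y} {y zero} {y zero * a} {tail y′} {y′ zero} {y′ zero * a}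
        (≈⇒SameCoords λ t → ≈-trans (≡⇒≈ (sym (lin-Xa a y t))) (≈-trans (e t) (≡⇒≈ (lin-Xa a y′ t)))))
        where
        assemble : Vec≈ q (tail y) (tail y′) × y zero ≈[ q ] y′ zero × _ → Vec≈ q y y′
        assemble (_ , y₀≈ , _) zero = y₀≈
        assemble (rest≈ , _ , _) (suc k) = rest≈ k

      w-multiple∈Xa⇒≈0 : ∀ a δ y y′ → Vec≈ q (lin y (Xa a) +v δ *v w) (lin y′ (Xa a)) → δ ≈[ q ] 0
      w-multiple∈Xa⇒≈0 a δ y y′ e =
        +-cancelˡ-≈ (*-congʳ a (proj₁ (proj₂ coeffs))) (≈-trans (proj₂ (proj₂ coeffs)) (≡⇒≈ (sym (+-identityʳ _))))
        where
        absorb : ∀ L y₀ x a z δ → L + y₀ * x + y₀ * a * z + δ * z ≡ L + y₀ * x + (y₀ * a + δ) * z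
        absorb = solve-∀
        lin-Xa+δw : ∀ t → (lin y (Xa a) +v δ *v w) t ≡ comb (tail y) (y zero) (y zero * a + δ) t
        lin-Xa+δw t = trans (cong (_+ δ * w t) (lin-Xa a y t)) (absorb (lin (tail y) P t) (y zero) (u t) a (w t) δ)
        coeffs = comb-injective {tail y} {y zero} {y zero * a + δ} {tail y′} {y′ zero} {y′ zero * a}
          (≈⇒SameCoords λ t → ≈-trans (≡⇒≈ (sym (lin-Xa+δw t))) (≈-trans (e t) (≡⇒≈ (lin-Xa a y′ t))))

      Xa⊆Xb⇒unit : ∀ a c → Xa a ⊆[ q ] Xb c → ∃ λ e → (e * c) ≈[ q ] 1
      Xa⊆Xb⇒unit a c Xa⊆Xb = conclude (Xa⊆Xb (u +v a *v w) (row∈span (Xa a) zero))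
        where
        conclude : InSpan q (Xb c) (u +v a *v w) → ∃ λ e → (e * c) ≈[ q ] 1
        conclude (e , e≈lead) = e zero , proj₁ (proj₂ (comb-injective {tail e} {e zero * c} {e zero} {𝟘} {1} {a}
          (≈⇒SameCoords λ t → ≈-trans (≡⇒≈ (sym (lin-Xb c e t))) (≈-trans (e≈lead t) (≡⇒≈ (lead≡comb a t))))))

      module Cover (X : Mat (suc m′) n) (F : Mat n (suc m′)) (XF : MatEq q (X · F) (identity (suc m′)))
                   (P⊆X : P ⊆[ q ] X) (X⊆Q : X ⊆[ q ] Q) where

        β γ : Fin (suc m′) → ℕ
        β i = proj (X i) j
        γ i = proj (X i) j′

        X≈comb : ∀ i → Vec≈ q (X i) (comb (lin (X i) D) (β i) (γ i))
        X≈comb i = decompose (X⊆Q (X i) (row∈span X i))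

        P-row∈X : ∀ k → InSpan q X (P k)
        P-row∈X k = P⊆X (P k) (row∈span P k)

        not-all-divisible : ¬ (∀ i → p ∣ β i × p ∣ γ i)
        not-all-divisible p∣βγ = <⇒≱ (n<1+n m′)
          (unimodular-in-span⇒≤ 1<p X F (λ i t → mod-p (XF i t)) P (λ i → lin (X i) D) X≈[lin]P)
          where
          X≈[lin]P : ∀ i t → X i t ≈[ p ] lin (lin (X i) D) P t
          X≈[lin]P i t = ≈-trans (mod-p (X≈comb i t)) (≈-trans
            (+-cong (+-cong ≈-refl (*-congʳ (u t) (∣⇒≈0 (proj₁ (p∣βγ i))))) (*-congʳ (w t) (∣⇒≈0 (proj₂ (p∣βγ i)))))
            (≡⇒≈ (trans (+-identityʳ _) (+-identityʳ _))))

        uw-part∈X : ∀ i → InSpan q X (β i *v u +v γ i *v w)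
        uw-part∈X i = span-resp X proj≈ (span-+* X (row∈span X i) (span-lin X P P-row∈X (lin (X i) D)) ν)
          where
          L : Vect n
          L = lin (lin (X i) D) P
          proj≈ : Vec≈ q (proj (X i)) (β i *v u +v γ i *v w)
          proj≈ t = begin
            X i t + ν * L t                         ≈⟨ +-cong (X≈comb i t) ≈-refl ⟩
            L t + β i * u t + γ i * w t + ν * L t   ≡⟨ regroup (L t) (β i * u t) (γ i * w t) ν ⟩
            β i * u t + γ i * w t + (L t + ν * L t) ≈⟨ +-cong ≈-refl (ν-inverse (L t)) ⟩
            β i * u t + γ i * w t + 0               ≡⟨ +-identityʳ _ ⟩
            β i * u t + γ i * w t                   ∎
            where
            open ≈-Reasoning q
            regroup : ∀ L a b ν → L + a + b + ν * L ≡ a + b + (L + ν * L)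
            regroup = solve-∀

        lead∈X : ∀ a ι i₀ → (ι * β i₀) ≈[ q ] 1 → a ≈[ q ] (ι * γ i₀) → InSpan q X (u +v a *v w)
        lead∈X a ι i₀ ιβ≈1 a≈ιγ = span-resp X scaled (span-* X ι (uw-part∈X i₀))
          where
          scaled : Vec≈ q (ι *v (β i₀ *v u +v γ i₀ *v w)) (u +v a *v w)
          scaled t = ≈-trans (≡⇒≈ (distribute ι (β i₀) (γ i₀) (u t) (w t)))
            (≈-trans (+-cong (*-congʳ (u t) ιβ≈1) (*-congʳ (w t) (≈-sym a≈ιγ))) (≡⇒≈ (cong (_+ a * w t) (*-identityˡ (u t)))))
            where
            distribute : ∀ ι b c x z → ι * (b * x + c * z) ≡ ι * b * x + ι * c * z
            distribute = solve-∀

        Xa-row∈X : ∀ a → InSpan q X (u +v a *v w) → ∀ i → InSpan q X (Xa a i)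
        Xa-row∈X a lead∈X zero = lead∈X
        Xa-row∈X a lead∈X (suc k) = P-row∈X k

        -- Otherwise row i minus β i times the lead leaves δ w with δ ≉ 0: a vector of X outside
        -- the span of Xa a, although Xa a has as many rows as X.
        slope : ∀ a → InSpan q X (u +v a *v w) → ∀ i → γ i ≈[ q ] (β i * a)
        slope a lead∈X i = decidable-stable (≈? q (γ i) (β i * a)) λ γ≉βa →
          independent-rows-span X F XF (Xa a) (Xa-row∈X a lead∈X) (Xa-independent a) δw∈X λ y y′ e →
            γ≉βa (≈-move (w-multiple∈Xa⇒≈0 a δ y y′ e))
          where
          δ : ℕ
          δ = γ i + ν * (β i * a)
          δw∈X : InSpan q X (δ *v w)
          δw∈X = span-resp X δw≈ (span-+* X (uw-part∈X i) lead∈X (ν * β i))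
            where
            collect : ∀ b c ν x a z → b * x + c * z + ν * b * (x + a * z) ≡ (b + ν * b) * x + (c + ν * (b * a)) * z
            collect = solve-∀
            δw≈ : Vec≈ q (β i *v u +v γ i *v w +v (ν * β i) *v (u +v a *v w)) (δ *v w)
            δw≈ t = ≈-trans (≡⇒≈ (collect (β i) (γ i) ν (u t) a (w t))) (+-cong (*-congʳ (u t) (ν-inverse (β i))) ≈-refl)

        X⊆Xa : ∀ a → InSpan q X (u +v a *v w) → X ⊆[ q ] Xa a
        X⊆Xa a lead∈X = rows⇒⊆ X (Xa a) λ i → (β i ∷ lin (X i) D) , λ t →
          ≈-trans (≡⇒≈ (lin-Xa a (β i ∷ lin (X i) D) t))
            (≈-trans (+-cong ≈-refl (*-congʳ (w t) (≈-sym (slope a lead∈X i)))) (≈-sym (X≈comb i t)))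

        spans-Xa : ∀ a ι i₀ → (ι * β i₀) ≈[ q ] 1 → a ≈[ q ] (ι * γ i₀) → SameSpan q X (Xa a)
        spans-Xa a ι i₀ ιβ≈1 a≈ιγ = X⊆Xa a lead∈ , rows⇒⊆ (Xa a) X (Xa-row∈X a lead∈)
          where
          lead∈ = lead∈X a ι i₀ ιβ≈1 a≈ιγ

    open Coordinates frame
    -- Swapped.Xa c is Xb c by definition.
    module Swapped = Coordinates (swapped frame)

    Xa-or-Xb : ∀ X → InStarTop q P Q X →
      (∃ λ (a : Fin q) → SameSpan q X (Xa (toℕ a))) ⊎ (∃ λ (b : Fin r) → SameSpan q X (Xb (p * toℕ b)))
    Xa-or-Xb X ((F , XF) , P⊆X , X⊆Q) =
      from-row (¬∀⟶∃¬ (suc m′) _ (λ i → (p ∣? β i) ×-dec (p ∣? γ i)) not-all-divisible)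
      where
      open Cover X F XF P⊆X X⊆Q
      module SC = Swapped.Cover X F XF P⊆X X⊆Q
      Xa-index : ∀ i₀ → ¬ (p ∣ β i₀) → ∃ λ (a : Fin q) → SameSpan q X (Xa (toℕ a))
      Xa-index i₀ p∤β = fromℕ< a<q , subst (λ a → SameSpan q X (Xa a)) (sym (toℕ-fromℕ< a<q))
        (spans-Xa ((ι * γ i₀) % q) ι i₀ ιβ≈1 (m%n≈m (ι * γ i₀)))
        where
        ι = proj₁ (unit-inverse pp p∤β (suc s′))
        ιβ≈1 = proj₂ (unit-inverse pp p∤β (suc s′))
        a<q : (ι * γ i₀) % q < q
        a<q = m%n<n (ι * γ i₀) q
      Xb-index : ∀ i₀ → p ∣ β i₀ → ¬ (p ∣ γ i₀) → ∃ λ (b : Fin r) → SameSpan q X (Xb (p * toℕ b))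
      Xb-index i₀ p∣β p∤γ = fromℕ< b<r , subst (λ b → SameSpan q X (Xb (p * b))) (sym (toℕ-fromℕ< b<r))
        (SC.spans-Xa (p * (t % r)) ι i₀ ιγ≈1 pb≈ιβ)
        where
        ι = proj₁ (unit-inverse pp p∤γ (suc s′))
        ιγ≈1 = proj₂ (unit-inverse pp p∤γ (suc s′))
        t = _∣_.quotient (∣n⇒∣m*n ι p∣β)
        b<r : t % r < r
        b<r = m%n<n t r
        pb≈ιβ : (p * (t % r)) ≈[ q ] (ι * β i₀)
        pb≈ιβ = ≈-trans (p*[t%r]≈t*p t) (≡⇒≈ (sym (_∣_.equality (∣n⇒∣m*n ι p∣β))))
      from-row : (∃ λ i → ¬ (p ∣ β i × p ∣ γ i)) →
        (∃ λ (a : Fin q) → SameSpan q X (Xa (toℕ a))) ⊎ (∃ λ (b : Fin r) → SameSpan q X (Xb (p * toℕ b)))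
      from-row (i₀ , ¬p∣βγ) with p ∣? β i₀
      ... | no p∤β = inj₁ (Xa-index i₀ p∤β)
      ... | yes p∣β = inj₂ (Xb-index i₀ p∣β (λ p∣γ → ¬p∣βγ (p∣β , p∣γ)))

    star-top-card : HasCard q (InStarTop q P Q) (q + r)
    star-top-card = HasCard-++ (λ a → Xa (toℕ a)) (λ b → Xb (p * toℕ b))
      (λ a → Xa∈ (toℕ a)) (λ b → Swapped.Xa∈ (p * toℕ b))
      (λ a a′ ss → toℕ-injective (≈-reduced⇒≡ (Xa-injective _ _ (proj₁ ss)) (toℕ<n a) (toℕ<n a′)))
      (λ b b′ ss → toℕ-injective (≈-reduced⇒≡ (p*-cancel (Swapped.Xa-injective _ _ (proj₁ ss))) (toℕ<n b) (toℕ<n b′)))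
      (λ a b ss → let (e , e[pb]≈1) = Xa⊆Xb⇒unit (toℕ a) (p * toℕ b) (proj₁ ss) in
        p-multiple≉1 (e * (p * toℕ b)) (∣n⇒∣m*n e (m∣m*n (toℕ b))) e[pb]≈1)
      Xa-or-Xb

lemma5p5 : (p s : ℕ) → Prime p → 1 ≤ s →
    (m n : ℕ) → 1 ≤ m → m < n →
    (P : Mat (m ∸ 1) n) → Unimodular (p ^ s) P →
    (Q : Mat (suc m) n) → Unimodular (p ^ s) Q →
    (∃ λ (X : Mat m n) → InStarTop (p ^ s) P Q X) →
    HasCard (p ^ s) {m} {n} (InStarTop (p ^ s) {m ∸ 1} {suc m} {m} {n} P Q) (p ^ (s ∸ 1) * (p + 1))
lemma5p5 p zero pp () m n _ _ P _ Q _ _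
lemma5p5 p (suc s) pp _ zero n () _ P _ Q _ _
lemma5p5 p (suc s) pp _ (suc m) n _ _ P (D , PD) Q (C , QC) (X , _ , P⊆X , X⊆Q) =
  subst (HasCard q (InStarTop q P Q)) (q+r≡r[p+1] r p)
    (Between.star-top-card P D PD Q C QC (λ v v∈P → X⊆Q v (P⊆X v v∈P)))
  where
  open PrimePower p s pp
  q+r≡r[p+1] : ∀ r p → p * r + r ≡ r * (p + 1)
  q+r≡r[p+1] = solve-∀
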